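{- Let $n$ be odd and $\lambda=(\frac{n+1}{2},1^{\frac{n-1}{2}})$. Then the number of standard Young tableaux $P$ of shape $\lambda$ with $\epsilon(P)^T=P$ equals $2^{\frac{n-1}{2}}$.
   Context: $T^T$ denotes the transpose. Evacuation $\epsilon$: for a tableau $Q$ with minimal entry $m$ in cell $\alpha$, $\Delta Q$ is obtained by erasing $m$ and performing a forward jeu de taquin slide into $\alpha$ (repeatedly move into the empty cell the smaller of the entries immediately to its right and immediately below it, until the empty cell has neither, and then delete it). For $Q$ standard with $n$ entries, $\epsilon(Q)$ is the tableau of the same shape whose cell $\beta$ contains $n-i$ where $\beta$ is the cell vacated in passing from $\Delta^iQ$ to $\Delta^{i+1}Q$, $0\le i\le n-1$. -}

module Defs where

open import Data.Nat using (ℕ; zero; suc; _+_; _∸_; _<_; _<ᵇ_)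
open import Data.Bool using (Bool; true; false; if_then_else_)
open import Data.List using (List; []; _∷_; length; map; concat; upTo; filter; mapMaybe; replicate; foldr)
open import Data.List.Relation.Unary.All using (All)
open import Data.List.Relation.Unary.Linked using (Linked)
open import Data.List.Relation.Binary.Permutation.Propositional using (_↭_)
open import Data.Nat.ListAction using (sum)
open import Data.Maybe using (Maybe; just; nothing)
open import Data.Product using (_×_; _,_; proj₁; proj₂)
open import Relation.Binary.PropositionalEquality using (_≡_)
open import Relation.Nullary using (¬_)
open import Relation.Unary using (∁)

-- A (straight-shape, left-justified) tableau: the list of its rows, top to bottom
-- (English convention: row i, column j; entries increase to the right and downward).
Tableau : Set
Tableau = List (List ℕ)

Shape : Set
Shape = List ℕ

shape : Tableau → Shape
shape = map length

size : Tableau → ℕ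
size T = length (concat T)

at : List ℕ → ℕ → Maybe ℕ
at []       _       = nothing
at (x ∷ xs) zero    = just x
at (x ∷ xs) (suc j) = at xs j

get : Tableau → ℕ → ℕ → Maybe ℕ
get []       _       j = nothing
get (r ∷ rs) zero    j = at r j
get (r ∷ rs) (suc i) j = get rs i j

setAt : List ℕ → ℕ → ℕ → List ℕ
setAt []       _       v = []
setAt (x ∷ xs) zero    v = v ∷ xs
setAt (x ∷ xs) (suc j) v = x ∷ setAt xs j v

set : Tableau → ℕ → ℕ → ℕ → Tableau
set []       _       j v = []
set (r ∷ rs) zero    j v = setAt r j v ∷ rs
set (r ∷ rs) (suc i) j v = r ∷ set rs i j v

removeAt : List ℕ → ℕ → List ℕ
removeAt []       _       = []
removeAt (x ∷ xs) zero    = xs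
removeAt (x ∷ xs) (suc j) = x ∷ removeAt xs j

nonEmpty : List ℕ → Bool
nonEmpty []      = false
nonEmpty (_ ∷ _) = true

dropEmpty : Tableau → Tableau
dropEmpty []       = []
dropEmpty (r ∷ rs) = if nonEmpty r then r ∷ dropEmpty rs else dropEmpty rs

-- delete cell (i , j) (used only at an outer corner, where it is the last cell of its row)
deleteCell : Tableau → ℕ → ℕ → Tableau
deleteCell []       _       j = []
deleteCell (r ∷ rs) zero    j = dropEmpty (removeAt r j ∷ rs)
deleteCell (r ∷ rs) (suc i) j = dropEmpty (r ∷ deleteCell rs i j)

Cell : Set
Cell = ℕ × ℕ

-- The fuel argument only ensures termination; the hole moves strictly
-- right/down, so fuel = number of cells is always sufficient.
slide : ℕ → Tableau → ℕ → ℕ → Tableau × Cell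
slide zero       T i j = deleteCell T i j , (i , j)
slide (suc fuel) T i j with get T i (suc j) | get T (suc i) j
... | nothing | nothing = deleteCell T i j , (i , j)
... | just r  | nothing = slide fuel (set T i j r) i (suc j)
... | nothing | just b  = slide fuel (set T i j b) (suc i) j
... | just r  | just b  =
  if r <ᵇ b then slide fuel (set T i j r) i (suc j)
            else slide fuel (set T i j b) (suc i) j

cellsRow : ℕ → ℕ → List ℕ → List (ℕ × Cell)
cellsRow i j []       = []
cellsRow i j (x ∷ xs) = (x , (i , j)) ∷ cellsRow i (suc j) xs

cellsFrom : ℕ → Tableau → List (ℕ × Cell)
cellsFrom i []       = []
cellsFrom i (r ∷ rs) = cellsRow i 0 r Data.List.++ cellsFrom (suc i) rs

minCell : Tableau → Maybe Cell
minCell T = Data.Maybe.map proj₂ (foldr pick nothing (cellsFrom 0 T))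
  where
  pick : ℕ × Cell → Maybe (ℕ × Cell) → Maybe (ℕ × Cell)
  pick e nothing  = just e
  pick e (just f) = if proj₁ e <ᵇ proj₁ f then just e else just f

Δ : Tableau → Tableau × Maybe Cell
Δ T with minCell T
... | nothing      = T , nothing
... | just (i , j) with slide (size T) T i j
...   | T' , β = T' , just β

-- Evacuation: ε(Q) has the shape of Q, and the cell vacated in passing from Δ^i Q to
-- Δ^{i+1} Q receives n - i (n = number of entries), 0 ≤ i ≤ n - 1.
evacLoop : ℕ → ℕ → ℕ → Tableau → Tableau → Tableau
evacLoop n i zero       Q R = R
evacLoop n i (suc fuel) Q R with Δ Q
... | Q' , nothing      = R
... | Q' , just (a , b) = evacLoop n (suc i) fuel Q' (set R a b (n ∸ i))

ε : Tableau → Tableau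
ε Q = evacLoop (size Q) 0 (size Q) Q Q

columns : ℕ → Tableau → Tableau
columns j []       = []
columns j (r ∷ rs) = map (λ k → mapMaybe (λ row → at row k) (r ∷ rs)) (Data.List.drop j (upTo (length r)))

_ᵀ : Tableau → Tableau
T ᵀ = columns 0 T

record IsSYT (λs : Shape) (T : Tableau) : Set where
  field
    hasShape   : shape T ≡ λs
    rowsInc    : All (Linked _<_) T
    colsInc    : ∀ i j a b → get T i j ≡ just a → get T (suc i) j ≡ just b → a < b
    entries    : concat T ↭ map suc (upTo (sum λs))

-- the hook shape (k+1, 1^k), of size n = 2k+1
hook : ℕ → Shape
hook k = suc k ∷ replicate k 1

-- A standard tableau of hook shape (k+1, 1^k) is determined by a word w of length 2k over
-- Bool: the entries 2, …, 2k+1 are placed in the arm (first row) at the letters true and in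
-- the leg (first column) at the letters false.  Each Δ removes the corner (the least entry)
-- and slides the hole straight to the end of the arm or of the leg, according to the first
-- letter of w, leaving the hook tableau of the tail of w; reading off the vacated cells shows
-- that ε reverses the word, while transposition complements it.  Hence ε(P)ᵀ = P exactly when
-- w equals its reversed complement, i.e. w = u ++ dual u for one of the 2^k words u of
-- length k.

module Submission where

open import Defs
open import Data.Nat using (ℕ; zero; suc; _+_; _∸_; _^_; _⊓_; _≤_; _<_; _<ᵇ_; s≤s)
open import Data.Nat.Properties
open import Data.Bool using (Bool; true; false; not; if_then_else_)
open import Data.Product using (Σ; ∃; _×_; _,_; proj₁; proj₂)
open import Data.Sum using (inj₁; inj₂)
open import Data.Maybe using (Maybe; just; nothing; maybe′)
import Data.Maybe as Maybe using (map)
import Data.Maybe.Relation.Unary.All as Maybe using (All; just; nothing)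
open import Data.List
  using (List; []; _∷_; _++_; _∷ʳ_; [_]; length; map; concat; foldr; reverse; replicate; applyUpTo; upTo; mapMaybe; catMaybes)
open import Data.List.Properties
open import Data.List.Relation.Unary.All using (All; []; _∷_)
import Data.List.Relation.Unary.All as All
import Data.List.Relation.Unary.All.Properties as All
open import Data.List.Relation.Unary.Linked using (Linked; []; [-]; _∷_)
import Data.List.Relation.Unary.Linked as Linked
open import Data.List.Relation.Unary.Linked.Properties using (Linked⇒AllPairs)
open import Data.List.Relation.Unary.AllPairs using ([]; _∷_)
open import Data.List.Relation.Unary.Any using (here; there)
open import Data.List.Relation.Binary.Permutation.Propositional using (_↭_; ↭-refl; ↭-prep; ↭-sym; ↭-trans)
open import Data.List.Relation.Binary.Permutation.Propositional.Properties using (shift; drop-∷; ∈-resp-↭; ↭-length)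
open import Data.List.Membership.Propositional.Properties using (∈-++⁻; ∈-++⁺ˡ; ∈-++⁺ʳ; ∈-map⁺; ∈-map⁻)
open import Data.Nat.ListAction using (sum)
open import Data.List.Membership.Propositional using (_∈_)
open import Data.List.Relation.Unary.Unique.Propositional using (Unique)
import Data.List.Relation.Unary.Unique.Propositional.Properties as Unique
open import Function.Bundles using (_⇔_; mk⇔)
open import Relation.Binary.PropositionalEquality hiding ([_])
open import Relation.Nullary.Reflects using (ofʸ; ofⁿ)
open import Data.Empty using (⊥; ⊥-elim)
open import Data.Bool.Properties using (not-involutive)
open import Function using (id; _∘_)

-- Hook tableaux and their words

indicesFrom : ℕ → List Bool → List ℕ
indicesFrom s []          = []
indicesFrom s (true ∷ w)  = s ∷ indicesFrom (suc s) w
indicesFrom s (false ∷ w) = indicesFrom (suc s) w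

countTrue : List Bool → ℕ
countTrue []          = 0
countTrue (true ∷ w)  = suc (countTrue w)
countTrue (false ∷ w) = countTrue w

dual : List Bool → List Bool
dual w = map not (reverse w)

column : List ℕ → Tableau
column = map [_]

armLeg : ℕ → List ℕ → List ℕ → Tableau
armLeg c arm leg = (c ∷ arm) ∷ column leg

hookTableau : ℕ → ℕ → List Bool → Tableau
hookTableau c s w = armLeg c (indicesFrom s w) (indicesFrom s (map not w))

hookSYT : List Bool → Tableau
hookSYT = hookTableau 1 2

length-indicesFrom : ∀ s w → length (indicesFrom s w) ≡ countTrue w
length-indicesFrom s []          = refl
length-indicesFrom s (true ∷ w)  = cong suc (length-indicesFrom (suc s) w)
length-indicesFrom s (false ∷ w) = length-indicesFrom (suc s) w

countTrue+countTrue-not : ∀ w → countTrue w + countTrue (map not w) ≡ length w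
countTrue+countTrue-not []          = refl
countTrue+countTrue-not (true ∷ w)  = cong suc (countTrue+countTrue-not w)
countTrue+countTrue-not (false ∷ w) =
  trans (+-suc (countTrue w) _) (cong suc (countTrue+countTrue-not w))

indicesFrom-≥ : ∀ s w → All (s ≤_) (indicesFrom s w)
indicesFrom-≥ s []          = []
indicesFrom-≥ s (true ∷ w)  = ≤-refl ∷ All.map (≤-trans (n≤1+n s)) (indicesFrom-≥ (suc s) w)
indicesFrom-≥ s (false ∷ w) = All.map (≤-trans (n≤1+n s)) (indicesFrom-≥ (suc s) w)

indicesFrom-linked : ∀ {t s} w → t < s → Linked _<_ (t ∷ indicesFrom s w)
indicesFrom-linked []          _   = [-]
indicesFrom-linked (true ∷ w)  t<s = t<s ∷ indicesFrom-linked w ≤-refl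
indicesFrom-linked (false ∷ w) t<s = indicesFrom-linked w (m<n⇒m<1+n t<s)

length-indicesFrom-≤ : ∀ s w → length (indicesFrom s w) ≤ length w
length-indicesFrom-≤ s w = begin
  length (indicesFrom s w)            ≡⟨ length-indicesFrom s w ⟩
  countTrue w                         ≤⟨ m≤m+n (countTrue w) _ ⟩
  countTrue w + countTrue (map not w) ≡⟨ countTrue+countTrue-not w ⟩
  length w                            ∎
  where open ≤-Reasoning

indicesFrom-++ : ∀ s xs ys → indicesFrom s (xs ++ ys) ≡ indicesFrom s xs ++ indicesFrom (s + length xs) ys
indicesFrom-++ s []          ys = cong (λ t → indicesFrom t ys) (sym (+-identityʳ s))
indicesFrom-++ s (true ∷ xs)  ys = cong (s ∷_) (trans (indicesFrom-++ (suc s) xs ys)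
  (cong (λ t → indicesFrom (suc s) xs ++ indicesFrom t ys) (sym (+-suc s (length xs)))))
indicesFrom-++ s (false ∷ xs) ys = trans (indicesFrom-++ (suc s) xs ys)
  (cong (λ t → indicesFrom (suc s) xs ++ indicesFrom t ys) (sym (+-suc s (length xs))))

s∷xs≢indicesFrom-suc : ∀ s {xs} v → s ∷ xs ≢ indicesFrom (suc s) v
s∷xs≢indicesFrom-suc s v e = <-irrefl refl (All.head (subst (All (suc s ≤_)) (sym e) (indicesFrom-≥ (suc s) v)))

indicesFrom-injective : ∀ s w v → indicesFrom s w ≡ indicesFrom s v →
                        indicesFrom s (map not w) ≡ indicesFrom s (map not v) → w ≡ v
indicesFrom-injective s []          []          _  _  = refl
indicesFrom-injective s (true ∷ w)  (true ∷ v)  e₁ e₂ =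
  cong (true ∷_) (indicesFrom-injective (suc s) w v (∷-injectiveʳ e₁) e₂)
indicesFrom-injective s (false ∷ w) (false ∷ v) e₁ e₂ =
  cong (false ∷_) (indicesFrom-injective (suc s) w v e₁ (∷-injectiveʳ e₂))
indicesFrom-injective s (true ∷ w)  (false ∷ v) e₁ _  = ⊥-elim (s∷xs≢indicesFrom-suc s v e₁)
indicesFrom-injective s (false ∷ w) (true ∷ v)  _  e₂ = ⊥-elim (s∷xs≢indicesFrom-suc s (map not v) e₂)
indicesFrom-injective s []          (true ∷ v)  () _
indicesFrom-injective s []          (false ∷ v) _  ()
indicesFrom-injective s (true ∷ w)  []          () _
indicesFrom-injective s (false ∷ w) []          _  ()

hookSYT-injective : ∀ {w v} → hookSYT w ≡ hookSYT v → w ≡ v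
hookSYT-injective {w} {v} e = indicesFrom-injective 2 w v
  (∷-injectiveʳ (∷-injectiveˡ e)) (map-injective ∷-injectiveˡ (∷-injectiveʳ e))

-- Jeu de taquin on a hook

get-column-zero : ∀ xs i → get (column xs) i 0 ≡ at xs i
get-column-zero []       i       = refl
get-column-zero (x ∷ xs) zero    = refl
get-column-zero (x ∷ xs) (suc i) = get-column-zero xs i

get-column-suc : ∀ xs i j → get (column xs) i (suc j) ≡ nothing
get-column-suc []       i       j = refl
get-column-suc (x ∷ xs) zero    j = refl
get-column-suc (x ∷ xs) (suc i) j = get-column-suc xs i j

set-column : ∀ xs i v → set (column xs) i 0 v ≡ column (setAt xs i v)
set-column []       i       v = refl
set-column (x ∷ xs) zero    v = refl
set-column (x ∷ xs) (suc i) v = cong ([ x ] ∷_) (set-column xs i v)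

dropEmpty-column : ∀ xs → dropEmpty (column xs) ≡ column xs
dropEmpty-column []       = refl
dropEmpty-column (x ∷ xs) = cong ([ x ] ∷_) (dropEmpty-column xs)

deleteCell-column : ∀ xs i → deleteCell (column xs) i 0 ≡ column (removeAt xs i)
deleteCell-column []       i       = refl
deleteCell-column (x ∷ xs) zero    = dropEmpty-column xs
deleteCell-column (x ∷ xs) (suc i) =
  trans (cong (λ c → dropEmpty ([ x ] ∷ c)) (deleteCell-column xs i)) (dropEmpty-column (x ∷ removeAt xs i))

concat-column : ∀ xs → concat (column xs) ≡ xs
concat-column []       = refl
concat-column (x ∷ xs) = cong (x ∷_) (concat-column xs)

at-++-∷ : ∀ (xs : List ℕ) y ys → at (xs ++ y ∷ ys) (suc (length xs)) ≡ at ys 0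
at-++-∷ []       y ys = refl
at-++-∷ (x ∷ xs) y ys = at-++-∷ xs y ys

setAt-++-∷ : ∀ (xs : List ℕ) y ys v → setAt (xs ++ y ∷ ys) (length xs) v ≡ xs ++ v ∷ ys
setAt-++-∷ []       y ys v = refl
setAt-++-∷ (x ∷ xs) y ys v = cong (x ∷_) (setAt-++-∷ xs y ys v)

removeAt-++-∷ : ∀ (xs : List ℕ) y ys → removeAt (xs ++ y ∷ ys) (length xs) ≡ xs ++ ys
removeAt-++-∷ []       y ys = refl
removeAt-++-∷ (x ∷ xs) y ys = cong (x ∷_) (removeAt-++-∷ xs y ys)

length-∷ʳ : ∀ (xs : List ℕ) x → length (xs ∷ʳ x) ≡ suc (length xs)
length-∷ʳ xs x = trans (length-++ xs) (+-comm (length xs) 1)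

≡nothing⇒All : ∀ {P : ℕ → Set} {m : Maybe ℕ} → m ≡ nothing → Maybe.All P m
≡nothing⇒All refl = Maybe.nothing

module _ (T : Tableau) (i j : ℕ) where

  slide-stop : ∀ f → get T i (suc j) ≡ nothing → get T (suc i) j ≡ nothing →
               slide f T i j ≡ (deleteCell T i j , (i , j))
  slide-stop zero    _     _     = refl
  slide-stop (suc f) right below rewrite right | below = refl

  slide-right : ∀ f {r} → get T i (suc j) ≡ just r → Maybe.All (r <_) (get T (suc i) j) →
                slide (suc f) T i j ≡ slide f (set T i j r) i (suc j)
  slide-right f {r} right below rewrite right with get T (suc i) j | below
  ... | nothing | _              = refl
  ... | just b  | Maybe.just r<b with r <ᵇ b | <ᵇ-reflects-< r b
  ...   | true  | _         = refl
  ...   | false | ofⁿ r≮b   = ⊥-elim (r≮b r<b)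

  slide-down : ∀ f {b} → get T (suc i) j ≡ just b → Maybe.All (b <_) (get T i (suc j)) →
               slide (suc f) T i j ≡ slide f (set T i j b) (suc i) j
  slide-down f {b} below right rewrite below with get T i (suc j) | right
  ... | nothing | _              = refl
  ... | just r  | Maybe.just b<r with r <ᵇ b | <ᵇ-reflects-< r b
  ...   | true  | ofʸ r<b   = ⊥-elim (<-asym r<b b<r)
  ...   | false | _         = refl

slide-along-arm : ∀ f d ds h rest leg → length rest ≤ f →
  slide f (armLeg d (ds ++ h ∷ rest) leg) 0 (suc (length ds))
    ≡ (armLeg d (ds ++ rest) leg , (0 , suc (length (ds ++ rest))))
slide-along-arm f d ds h [] leg _ = begin
  slide f T 0 (suc (length ds))
    ≡⟨ slide-stop T 0 _ f (at-++-∷ ds h []) (get-column-suc leg 0 (length ds)) ⟩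
  (deleteCell T 0 (suc (length ds)) , (0 , suc (length ds)))
    ≡⟨ cong₂ (λ xs c → (d ∷ xs) ∷ c , (0 , suc (length ds)))
             (removeAt-++-∷ ds h []) (dropEmpty-column leg) ⟩
  (armLeg d (ds ++ []) leg , (0 , suc (length ds)))
    ≡⟨ cong (λ xs → armLeg d (ds ++ []) leg , (0 , suc (length xs))) (sym (++-identityʳ ds)) ⟩
  (armLeg d (ds ++ []) leg , (0 , suc (length (ds ++ [])))) ∎
  where
  open ≡-Reasoning
  T = armLeg d (ds ++ h ∷ []) leg
slide-along-arm (suc f) d ds h (r ∷ rest) leg (s≤s rest≤f) = begin
  slide (suc f) (armLeg d (ds ++ h ∷ r ∷ rest) leg) 0 (suc (length ds))
    ≡⟨ slide-right (armLeg d (ds ++ h ∷ r ∷ rest) leg) 0 _ f (at-++-∷ ds h (r ∷ rest))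
         (≡nothing⇒All (get-column-suc leg 0 (length ds))) ⟩
  slide f (armLeg d (setAt (ds ++ h ∷ r ∷ rest) (length ds) r) leg) 0 (suc (suc (length ds)))
    ≡⟨ cong₂ (λ xs k → slide f (armLeg d xs leg) 0 k)
             (trans (setAt-++-∷ ds h (r ∷ rest) r) (sym (++-assoc ds [ r ] (r ∷ rest))))
             (cong suc (sym (length-∷ʳ ds r))) ⟩
  slide f (armLeg d ((ds ∷ʳ r) ++ r ∷ rest) leg) 0 (suc (length (ds ∷ʳ r)))
    ≡⟨ slide-along-arm f d (ds ∷ʳ r) r rest leg rest≤f ⟩
  (armLeg d ((ds ∷ʳ r) ++ rest) leg , (0 , suc (length ((ds ∷ʳ r) ++ rest))))
    ≡⟨ cong (λ xs → armLeg d xs leg , (0 , suc (length xs))) (++-assoc ds [ r ] rest) ⟩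
  (armLeg d (ds ++ r ∷ rest) leg , (0 , suc (length (ds ++ r ∷ rest)))) ∎
  where open ≡-Reasoning

slide-along-leg : ∀ f t ts dc h rest → length rest ≤ f →
  slide f (armLeg t ts (dc ++ h ∷ rest)) (suc (length dc)) 0
    ≡ (armLeg t ts (dc ++ rest) , (suc (length (dc ++ rest)) , 0))
slide-along-leg f t ts dc h [] _ = begin
  slide f T (suc (length dc)) 0
    ≡⟨ slide-stop T _ 0 f (get-column-suc (dc ++ h ∷ []) (length dc) 0)
         (trans (get-column-zero (dc ++ h ∷ []) (suc (length dc))) (at-++-∷ dc h [])) ⟩
  (deleteCell T (suc (length dc)) 0 , (suc (length dc) , 0))
    ≡⟨ cong (λ c → (t ∷ ts) ∷ c , (suc (length dc) , 0))
         (trans (cong dropEmpty (deleteCell-column (dc ++ h ∷ []) (length dc)))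
                (trans (dropEmpty-column _) (cong column (removeAt-++-∷ dc h [])))) ⟩
  (armLeg t ts (dc ++ []) , (suc (length dc) , 0))
    ≡⟨ cong (λ xs → armLeg t ts (dc ++ []) , (suc (length xs) , 0)) (sym (++-identityʳ dc)) ⟩
  (armLeg t ts (dc ++ []) , (suc (length (dc ++ [])) , 0)) ∎
  where
  open ≡-Reasoning
  T = armLeg t ts (dc ++ h ∷ [])
slide-along-leg (suc f) t ts dc h (r ∷ rest) (s≤s rest≤f) = begin
  slide (suc f) (armLeg t ts (dc ++ h ∷ r ∷ rest)) (suc (length dc)) 0
    ≡⟨ slide-down (armLeg t ts (dc ++ h ∷ r ∷ rest)) _ 0 f
         (trans (get-column-zero (dc ++ h ∷ r ∷ rest) (suc (length dc))) (at-++-∷ dc h (r ∷ rest)))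
         (≡nothing⇒All (get-column-suc (dc ++ h ∷ r ∷ rest) (length dc) 0)) ⟩
  slide f ((t ∷ ts) ∷ set (column (dc ++ h ∷ r ∷ rest)) (length dc) 0 r) (suc (suc (length dc))) 0
    ≡⟨ cong₂ (λ c k → slide f ((t ∷ ts) ∷ c) k 0)
             (trans (set-column (dc ++ h ∷ r ∷ rest) (length dc) r)
                    (cong column (trans (setAt-++-∷ dc h (r ∷ rest) r) (sym (++-assoc dc [ r ] (r ∷ rest))))))
             (cong suc (sym (length-∷ʳ dc r))) ⟩
  slide f (armLeg t ts ((dc ∷ʳ r) ++ r ∷ rest)) (suc (length (dc ∷ʳ r))) 0
    ≡⟨ slide-along-leg f t ts (dc ∷ʳ r) r rest rest≤f ⟩
  (armLeg t ts ((dc ∷ʳ r) ++ rest) , (suc (length ((dc ∷ʳ r) ++ rest)) , 0))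
    ≡⟨ cong (λ xs → armLeg t ts xs , (suc (length xs) , 0)) (++-assoc dc [ r ] rest) ⟩
  (armLeg t ts (dc ++ r ∷ rest) , (suc (length (dc ++ r ∷ rest)) , 0)) ∎
  where open ≡-Reasoning

All⇒Maybe-All-at : ∀ {P : ℕ → Set} {xs} → All P xs → ∀ i → Maybe.All P (at xs i)
All⇒Maybe-All-at []         i       = Maybe.nothing
All⇒Maybe-All-at (px ∷ _)   zero    = Maybe.just px
All⇒Maybe-All-at (_ ∷ pxs)  (suc i) = All⇒Maybe-All-at pxs i

-- A copy of the selector of minCell, whose definition in Defs is local to a where-block.
pickMin : ℕ × Cell → Maybe (ℕ × Cell) → Maybe (ℕ × Cell)
pickMin e nothing  = just e
pickMin e (just f) = if proj₁ e <ᵇ proj₁ f then just e else just f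

minCell-foldr : ∀ T → minCell T ≡ Maybe.map proj₂ (foldr pickMin nothing (cellsFrom 0 T))
minCell-foldr T =
  cong (Maybe.map proj₂) (foldr-cong (λ { e nothing → refl ; e (just f) → refl }) refl (cellsFrom 0 T))

foldr-pickMin-All : ∀ {P : ℕ × Cell → Set} {es} → All P es → Maybe.All P (foldr pickMin nothing es)
foldr-pickMin-All [] = Maybe.nothing
foldr-pickMin-All {es = e ∷ es} (pe ∷ pes) with foldr pickMin nothing es | foldr-pickMin-All pes
... | nothing | _            = Maybe.just pe
... | just f  | Maybe.just pf with proj₁ e <ᵇ proj₁ f
...   | true  = Maybe.just pe
...   | false = Maybe.just pf

foldr-pickMin-least : ∀ c α es → All (λ e → c < proj₁ e) es →
                      foldr pickMin nothing ((c , α) ∷ es) ≡ just (c , α)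
foldr-pickMin-least c α es c<es with foldr pickMin nothing es | foldr-pickMin-All c<es
... | nothing | _              = refl
... | just f  | Maybe.just c<f with c <ᵇ proj₁ f | <ᵇ-reflects-< c (proj₁ f)
...   | true  | _       = refl
...   | false | ofⁿ c≮f = ⊥-elim (c≮f c<f)

entries-cellsRow : ∀ i j r → map proj₁ (cellsRow i j r) ≡ r
entries-cellsRow i j []      = refl
entries-cellsRow i j (x ∷ r) = cong (x ∷_) (entries-cellsRow i (suc j) r)

entries-cellsFrom : ∀ i T → map proj₁ (cellsFrom i T) ≡ concat T
entries-cellsFrom i []       = refl
entries-cellsFrom i (r ∷ rs) = trans (map-++ proj₁ (cellsRow i 0 r) (cellsFrom (suc i) rs))
  (cong₂ _++_ (entries-cellsRow i 0 r) (entries-cellsFrom (suc i) rs))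

minCell-corner : ∀ c r rs → All (c <_) (concat (r ∷ rs)) → minCell ((c ∷ r) ∷ rs) ≡ just (0 , 0)
minCell-corner c r rs c<rest = begin
  minCell ((c ∷ r) ∷ rs)
    ≡⟨ minCell-foldr ((c ∷ r) ∷ rs) ⟩
  Maybe.map proj₂ (foldr pickMin nothing ((c , (0 , 0)) ∷ es))
    ≡⟨ cong (Maybe.map proj₂) (foldr-pickMin-least c (0 , 0) es (All.map⁻ c<es)) ⟩
  just (0 , 0) ∎
  where
  open ≡-Reasoning
  es = cellsRow 0 1 r ++ cellsFrom 1 rs
  c<es : All (c <_) (map proj₁ es)
  c<es = subst (All (c <_))
    (sym (trans (map-++ proj₁ (cellsRow 0 1 r) _) (cong₂ _++_ (entries-cellsRow 0 1 r) (entries-cellsFrom 1 rs))))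
    c<rest

Δ-by-slide : ∀ T {i j T′ β} → minCell T ≡ just (i , j) → slide (size T) T i j ≡ (T′ , β) →
             Δ T ≡ (T′ , just β)
Δ-by-slide T min≡ slide≡ rewrite min≡ | slide≡ = refl

size-hookTableau : ∀ c s w → size (hookTableau c s w) ≡ suc (length w)
size-hookTableau c s w = cong suc (begin
  length (indicesFrom s w ++ concat (column (indicesFrom s (map not w))))
    ≡⟨ cong (λ l → length (indicesFrom s w ++ l)) (concat-column _) ⟩
  length (indicesFrom s w ++ indicesFrom s (map not w))
    ≡⟨ length-++ (indicesFrom s w) ⟩
  length (indicesFrom s w) + length (indicesFrom s (map not w))
    ≡⟨ cong₂ _+_ (length-indicesFrom s w) (length-indicesFrom s (map not w)) ⟩
  countTrue w + countTrue (map not w)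
    ≡⟨ countTrue+countTrue-not w ⟩
  length w ∎)
  where open ≡-Reasoning

minCell-hookTableau : ∀ {c s} w → c < s → minCell (hookTableau c s w) ≡ just (0 , 0)
minCell-hookTableau {c} {s} w c<s = minCell-corner c (indicesFrom s w) (column (indicesFrom s (map not w)))
  (subst (All (c <_)) (cong (indicesFrom s w ++_) (sym (concat-column _)))
    (All.++⁺ (above (indicesFrom-≥ s w)) (above (indicesFrom-≥ s (map not w)))))
  where
  above : ∀ {xs} → All (s ≤_) xs → All (c <_) xs
  above = All.map (<-≤-trans c<s)

Δ-hookTableau-arm : ∀ {c s} w → c < s →
  Δ (hookTableau c s (true ∷ w)) ≡ (hookTableau s (suc s) w , just (0 , suc (length (indicesFrom (suc s) w))))
Δ-hookTableau-arm {c} {s} w c<s = Δ-by-slide T (minCell-hookTableau (true ∷ w) c<s) (begin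
  slide (size T) T 0 0
    ≡⟨ cong (λ f → slide f T 0 0) (size-hookTableau c s (true ∷ w)) ⟩
  slide (suc (suc (length w))) T 0 0
    ≡⟨ slide-right T 0 0 (suc (length w)) refl
         (subst (Maybe.All (s <_)) (sym (get-column-zero leg 0))
                (All⇒Maybe-All-at (indicesFrom-≥ (suc s) (map not w)) 0)) ⟩
  slide (suc (length w)) (armLeg s (s ∷ arm) leg) 0 1
    ≡⟨ slide-along-arm (suc (length w)) s [] s arm leg (≤-trans (length-indicesFrom-≤ (suc s) w) (n≤1+n _)) ⟩
  (hookTableau s (suc s) w , (0 , suc (length arm))) ∎)
  where
  open ≡-Reasoning
  T = hookTableau c s (true ∷ w)
  arm = indicesFrom (suc s) w
  leg = indicesFrom (suc s) (map not w)

Δ-hookTableau-leg : ∀ {c s} w → c < s →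
  Δ (hookTableau c s (false ∷ w))
    ≡ (hookTableau s (suc s) w , just (suc (length (indicesFrom (suc s) (map not w))) , 0))
Δ-hookTableau-leg {c} {s} w c<s = Δ-by-slide T (minCell-hookTableau (false ∷ w) c<s) (begin
  slide (size T) T 0 0
    ≡⟨ cong (λ f → slide f T 0 0) (size-hookTableau c s (false ∷ w)) ⟩
  slide (suc (suc (length w))) T 0 0
    ≡⟨ slide-down T 0 0 (suc (length w)) refl (All⇒Maybe-All-at (indicesFrom-≥ (suc s) w) 0) ⟩
  slide (suc (length w)) (armLeg s arm (s ∷ leg)) 1 0
    ≡⟨ slide-along-leg (suc (length w)) s arm [] s leg
         (≤-trans (length-indicesFrom-≤ (suc s) (map not w)) (≤-trans (≤-reflexive (length-map not w)) (n≤1+n _))) ⟩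
  (hookTableau s (suc s) w , (suc (length leg) , 0)) ∎)
  where
  open ≡-Reasoning
  T = hookTableau c s (false ∷ w)
  arm = indicesFrom (suc s) w
  leg = indicesFrom (suc s) (map not w)

-- Evacuation and transposition

indicesFrom-reverse-∷ : ∀ s b w rest →
  indicesFrom s (reverse (b ∷ w)) ++ rest ≡ indicesFrom s (reverse w) ++ indicesFrom (s + length w) [ b ] ++ rest
indicesFrom-reverse-∷ s b w rest = begin
  indicesFrom s (reverse (b ∷ w)) ++ rest
    ≡⟨ cong (λ v → indicesFrom s v ++ rest) (unfold-reverse b w) ⟩
  indicesFrom s (reverse w ++ [ b ]) ++ rest
    ≡⟨ cong (_++ rest) (indicesFrom-++ s (reverse w) [ b ]) ⟩
  (indicesFrom s (reverse w) ++ indicesFrom (s + length (reverse w)) [ b ]) ++ rest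
    ≡⟨ ++-assoc (indicesFrom s (reverse w)) _ rest ⟩
  indicesFrom s (reverse w) ++ indicesFrom (s + length (reverse w)) [ b ] ++ rest
    ≡⟨ cong (λ l → indicesFrom s (reverse w) ++ indicesFrom (s + l) [ b ] ++ rest) (length-reverse w) ⟩
  indicesFrom s (reverse w) ++ indicesFrom (s + length w) [ b ] ++ rest ∎
  where open ≡-Reasoning

indicesFrom-not-reverse-∷ : ∀ s b w rest →
  indicesFrom s (map not (reverse (b ∷ w))) ++ rest
    ≡ indicesFrom s (map not (reverse w)) ++ indicesFrom (s + length w) [ not b ] ++ rest
indicesFrom-not-reverse-∷ s b w rest = begin
  indicesFrom s (map not (reverse (b ∷ w))) ++ rest
    ≡⟨ cong (λ v → indicesFrom s v ++ rest) (reverse-map not (b ∷ w)) ⟩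
  indicesFrom s (reverse (not b ∷ map not w)) ++ rest
    ≡⟨ indicesFrom-reverse-∷ s (not b) (map not w) rest ⟩
  indicesFrom s (reverse (map not w)) ++ indicesFrom (s + length (map not w)) [ not b ] ++ rest
    ≡⟨ cong₂ (λ v l → indicesFrom s v ++ indicesFrom (s + l) [ not b ] ++ rest)
             (sym (reverse-map not w)) (length-map not w) ⟩
  indicesFrom s (map not (reverse w)) ++ indicesFrom (s + length w) [ not b ] ++ rest ∎
  where open ≡-Reasoning

setAt-++-last : ∀ (xs ys : List ℕ) m v → length xs ≡ suc m →
                ∃ λ xs′ → length xs′ ≡ m × setAt (xs ++ ys) m v ≡ xs′ ++ v ∷ ys
setAt-++-last (x ∷ [])      ys zero    v _  = [] , refl , refl
setAt-++-last (x ∷ x′ ∷ xs) ys (suc m) v eq with setAt-++-last (x′ ∷ xs) ys m v (suc-injective eq)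
... | xs′ , len , eq′ = x ∷ xs′ , cong suc len , cong (x ∷_) eq′

evacLoop-step : ∀ n i f {Q Q′ a b} R → Δ Q ≡ (Q′ , just (a , b)) →
                evacLoop n i (suc f) Q R ≡ evacLoop n (suc i) f Q′ (set R a b (n ∸ i))
evacLoop-step n i f R Δ≡ rewrite Δ≡ = refl

+-≡⇒∸≡ : ∀ i l m {n} → i + (suc l + m) ≡ n → n ∸ i ≡ suc m + l
+-≡⇒∸≡ i l m n≡ = trans (cong (_∸ i) (sym n≡)) (trans (m+n∸m≡n i _) (cong suc (+-comm l m)))

-- rj and cj are the parts of the arm and leg of R not yet relabelled; the labels still to be
-- written are n ∸ i, n ∸ i ∸ 1, …, m.
evacLoop-hookTableau : ∀ {n i m c s} w x (rj rf cj cf : List ℕ) → c < s → i + (length w + m) ≡ n →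
  length rj ≡ length (indicesFrom s w) → length cj ≡ length (indicesFrom s (map not w)) →
  evacLoop n i (suc (length w)) (hookTableau c s w) (armLeg x (rj ++ rf) (cj ++ cf))
    ≡ armLeg m (indicesFrom (suc m) (reverse w) ++ rf) (indicesFrom (suc m) (map not (reverse w)) ++ cf)
evacLoop-hookTableau {n} {i} {m} [] x [] rf [] cf _ n≡ _ _ =
  cong (λ v → armLeg v rf cf) (trans (cong (_∸ i) (sym n≡)) (m+n∸m≡n i m))
evacLoop-hookTableau {n} {i} {m} {c} {s} (true ∷ w) x rj rf cj cf c<s n≡ rj≡ cj≡
  with rj′ , rj′≡ , setAt≡ ← setAt-++-last rj rf (length (indicesFrom (suc s) w)) (n ∸ i) rj≡ = begin
  evacLoop n i (suc (suc (length w))) (hookTableau c s (true ∷ w)) (armLeg x (rj ++ rf) (cj ++ cf))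
    ≡⟨ evacLoop-step n i (suc (length w)) _ (Δ-hookTableau-arm w c<s) ⟩
  continue (armLeg x (setAt (rj ++ rf) (length (indicesFrom (suc s) w)) (n ∸ i)) (cj ++ cf))
    ≡⟨ cong (λ r → continue (armLeg x r (cj ++ cf))) setAt≡ ⟩
  continue (armLeg x (rj′ ++ (n ∸ i) ∷ rf) (cj ++ cf))
    ≡⟨ evacLoop-hookTableau w x rj′ ((n ∸ i) ∷ rf) cj cf ≤-refl (trans (sym (+-suc i _)) n≡) rj′≡ cj≡ ⟩
  armLeg m (indicesFrom (suc m) (reverse w) ++ (n ∸ i) ∷ rf) (indicesFrom (suc m) (map not (reverse w)) ++ cf)
    ≡⟨ cong₂ (armLeg m)
         (trans (cong (λ v → indicesFrom (suc m) (reverse w) ++ v ∷ rf) (+-≡⇒∸≡ i (length w) m n≡))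
                (sym (indicesFrom-reverse-∷ (suc m) true w rf)))
         (sym (indicesFrom-not-reverse-∷ (suc m) true w cf)) ⟩
  armLeg m (indicesFrom (suc m) (reverse (true ∷ w)) ++ rf)
           (indicesFrom (suc m) (map not (reverse (true ∷ w))) ++ cf) ∎
  where
  open ≡-Reasoning
  continue : Tableau → Tableau
  continue = evacLoop n (suc i) (suc (length w)) (hookTableau s (suc s) w)
evacLoop-hookTableau {n} {i} {m} {c} {s} (false ∷ w) x rj rf cj cf c<s n≡ rj≡ cj≡
  with cj′ , cj′≡ , setAt≡ ← setAt-++-last cj cf (length (indicesFrom (suc s) (map not w))) (n ∸ i) cj≡ = begin
  evacLoop n i (suc (suc (length w))) (hookTableau c s (false ∷ w)) (armLeg x (rj ++ rf) (cj ++ cf))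
    ≡⟨ evacLoop-step n i (suc (length w)) _ (Δ-hookTableau-leg w c<s) ⟩
  continue ((x ∷ rj ++ rf) ∷ set (column (cj ++ cf)) (length (indicesFrom (suc s) (map not w))) 0 (n ∸ i))
    ≡⟨ cong (λ l → continue ((x ∷ rj ++ rf) ∷ l))
            (trans (set-column (cj ++ cf) _ (n ∸ i)) (cong column setAt≡)) ⟩
  continue (armLeg x (rj ++ rf) (cj′ ++ (n ∸ i) ∷ cf))
    ≡⟨ evacLoop-hookTableau w x rj rf cj′ ((n ∸ i) ∷ cf) ≤-refl (trans (sym (+-suc i _)) n≡) rj≡ cj′≡ ⟩
  armLeg m (indicesFrom (suc m) (reverse w) ++ rf) (indicesFrom (suc m) (map not (reverse w)) ++ (n ∸ i) ∷ cf)
    ≡⟨ cong₂ (armLeg m)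
         (sym (indicesFrom-reverse-∷ (suc m) false w rf))
         (trans (cong (λ v → indicesFrom (suc m) (map not (reverse w)) ++ v ∷ cf) (+-≡⇒∸≡ i (length w) m n≡))
                (sym (indicesFrom-not-reverse-∷ (suc m) false w cf))) ⟩
  armLeg m (indicesFrom (suc m) (reverse (false ∷ w)) ++ rf)
           (indicesFrom (suc m) (map not (reverse (false ∷ w))) ++ cf) ∎
  where
  open ≡-Reasoning
  continue : Tableau → Tableau
  continue = evacLoop n (suc i) (suc (length w)) (hookTableau s (suc s) w)

ε-hookSYT : ∀ w → ε (hookSYT w) ≡ hookSYT (reverse w)
ε-hookSYT w = begin
  ε (hookSYT w)
    ≡⟨ cong (λ n → evacLoop n 0 n (hookSYT w) (hookSYT w)) (size-hookTableau 1 2 w) ⟩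
  evacLoop (suc (length w)) 0 (suc (length w)) (hookSYT w) (hookSYT w)
    ≡⟨ cong₂ (λ r c → evacLoop (suc (length w)) 0 (suc (length w)) (hookSYT w) (armLeg 1 r c))
             (sym (++-identityʳ _)) (sym (++-identityʳ _)) ⟩
  evacLoop (suc (length w)) 0 (suc (length w)) (hookSYT w)
    (armLeg 1 (indicesFrom 2 w ++ []) (indicesFrom 2 (map not w) ++ []))
    ≡⟨ evacLoop-hookTableau w 1 (indicesFrom 2 w) [] (indicesFrom 2 (map not w)) []
         ≤-refl (+-comm (length w) 1) refl refl ⟩
  armLeg 1 (indicesFrom 2 (reverse w) ++ []) (indicesFrom 2 (map not (reverse w)) ++ [])
    ≡⟨ cong₂ (armLeg 1) (++-identityʳ _) (++-identityʳ _) ⟩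
  hookSYT (reverse w) ∎
  where open ≡-Reasoning

mapMaybe-at-zero-column : ∀ xs → mapMaybe (λ row → at row 0) (column xs) ≡ xs
mapMaybe-at-zero-column []       = refl
mapMaybe-at-zero-column (x ∷ xs) = cong (x ∷_) (mapMaybe-at-zero-column xs)

mapMaybe-at-suc-column : ∀ xs k → mapMaybe (λ row → at row (suc k)) (column xs) ≡ []
mapMaybe-at-suc-column []       k = refl
mapMaybe-at-suc-column (x ∷ xs) k = mapMaybe-at-suc-column xs k

applyUpTo-column : ∀ (r : List ℕ) {F : ℕ → List ℕ} → (∀ k → F k ≡ catMaybes [ at r k ]) →
                   applyUpTo F (length r) ≡ column r
applyUpTo-column []      _  = refl
applyUpTo-column (x ∷ r) F≗ = cong₂ _∷_ (F≗ 0) (applyUpTo-column r (F≗ ∘ suc))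

transpose-armLeg : ∀ a r c → (armLeg a r c) ᵀ ≡ armLeg a c r
transpose-armLeg a r c = cong₂ _∷_ (cong (a ∷_) (mapMaybe-at-zero-column c)) (begin
  map F (applyUpTo suc (length r))
    ≡⟨ map-applyUpTo suc F (length r) ⟩
  applyUpTo (F ∘ suc) (length r)
    ≡⟨ applyUpTo-column r (λ k → cong (maybe′ _∷_ id (at r k)) (mapMaybe-at-suc-column c k)) ⟩
  column r ∎)
  where
  open ≡-Reasoning
  F : ℕ → List ℕ
  F k = mapMaybe (λ row → at row k) (armLeg a r c)

map-not-involutive : ∀ w → map not (map not w) ≡ w
map-not-involutive w = trans (sym (map-∘ w)) (trans (map-cong not-involutive w) (map-id w))

ᵀ-hookTableau : ∀ c s w → (hookTableau c s w) ᵀ ≡ hookTableau c s (map not w)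
ᵀ-hookTableau c s w = trans (transpose-armLeg c (indicesFrom s w) _)
  (cong (λ w′ → armLeg c (indicesFrom s (map not w)) (indicesFrom s w′)) (sym (map-not-involutive w)))

εᵀ-hookSYT : ∀ w → (ε (hookSYT w)) ᵀ ≡ hookSYT (dual w)
εᵀ-hookSYT w = trans (cong _ᵀ (ε-hookSYT w)) (ᵀ-hookTableau 1 2 (reverse w))

-- Standard tableaux of hook shape

range : ℕ → ℕ → List ℕ
range s zero    = []
range s (suc n) = s ∷ range (suc s) n

applyUpTo-range : ∀ n s {f : ℕ → ℕ} → (∀ k → f k ≡ s + k) → applyUpTo f n ≡ range s n
applyUpTo-range zero    s f≗ = refl
applyUpTo-range (suc n) s f≗ =
  cong₂ _∷_ (trans (f≗ 0) (+-identityʳ s)) (applyUpTo-range n (suc s) (λ k → trans (f≗ (suc k)) (+-suc s k)))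

map-suc-upTo : ∀ n → map suc (upTo n) ≡ range 1 n
map-suc-upTo n = trans (map-upTo suc n) (applyUpTo-range n 1 (λ _ → refl))

∈-range⇒≥ : ∀ {y} s n → y ∈ range s n → s ≤ y
∈-range⇒≥ s (suc n) (here refl) = ≤-refl
∈-range⇒≥ s (suc n) (there y∈) = <⇒≤ (∈-range⇒≥ (suc s) n y∈)

sum-replicate-1 : ∀ k → sum (replicate k 1) ≡ k
sum-replicate-1 zero    = refl
sum-replicate-1 (suc k) = cong suc (sum-replicate-1 k)

entries-hook : ∀ k → map suc (upTo (sum (hook k))) ≡ range 1 (suc (k + k))
entries-hook k = trans (map-suc-upTo _) (cong (λ m → range 1 (suc (k + m))) (sum-replicate-1 k))

indicesFrom-↭-range : ∀ s w → indicesFrom s w ++ indicesFrom s (map not w) ↭ range s (length w)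
indicesFrom-↭-range s []          = ↭-refl
indicesFrom-↭-range s (true ∷ w)  = ↭-prep s (indicesFrom-↭-range (suc s) w)
indicesFrom-↭-range s (false ∷ w) =
  ↭-trans (shift s (indicesFrom (suc s) w) _) (↭-prep s (indicesFrom-↭-range (suc s) w))

Linked⇒All-< : ∀ {a xs} → Linked _<_ (a ∷ xs) → All (a <_) xs
Linked⇒All-< ↗ with Linked⇒AllPairs <-trans ↗
... | a<xs ∷ _ = a<xs

least-is-head : ∀ {a s xs} → Linked _<_ (a ∷ xs) → s ∈ a ∷ xs → s ≤ a → a ≡ s
least-is-head ↗ (here refl) _   = refl
least-is-head ↗ (there s∈) s≤a = ⊥-elim (<⇒≱ (All.lookup (Linked⇒All-< ↗) s∈) s≤a)

-- The least element s of the range heads A or B; removing it records the first letter.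
increasing-partition : ∀ n s {A B : List ℕ} → Linked _<_ A → Linked _<_ B → A ++ B ↭ range s n →
  ∃ λ w → length w ≡ n × A ≡ indicesFrom s w × B ≡ indicesFrom s (map not w)
increasing-partition zero    s {[]}    {[]}    _ _ _ = [] , refl , refl , refl
increasing-partition zero    s {a ∷ A} {B}     _ _ A++B↭ with () ← ↭-length A++B↭
increasing-partition zero    s {[]}    {b ∷ B} _ _ A++B↭ with () ← ↭-length A++B↭
increasing-partition (suc n) s {A}     {B}     ↗A ↗B A++B↭
  with ∈-++⁻ A (∈-resp-↭ (↭-sym A++B↭) (here refl))
increasing-partition (suc n) s {a ∷ A} {B}     ↗A ↗B A++B↭ | inj₁ s∈A
  with refl ← least-is-head ↗A s∈A (∈-range⇒≥ s (suc n) (∈-resp-↭ A++B↭ (here refl)))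
  with w , len , A≡ , B≡ ← increasing-partition n (suc s) (Linked.tail ↗A) ↗B (drop-∷ A++B↭)
  = true ∷ w , cong suc len , cong (s ∷_) A≡ , B≡
increasing-partition (suc n) s {A}     {b ∷ B} ↗A ↗B A++B↭ | inj₂ s∈B
  with refl ← least-is-head ↗B s∈B (∈-range⇒≥ s (suc n) (∈-resp-↭ A++B↭ (∈-++⁺ʳ A (here refl))))
  with w , len , A≡ , B≡ ← increasing-partition n (suc s) ↗A (Linked.tail ↗B)
                             (drop-∷ (↭-trans (↭-sym (shift s A B)) A++B↭))
  = false ∷ w , cong suc len , A≡ , cong (s ∷_) B≡

column-increasing : ∀ {xs} → Linked _<_ xs →
  ∀ i j a b → get (column xs) i j ≡ just a → get (column xs) (suc i) j ≡ just b → a < b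
column-increasing (a<b ∷ _) zero    zero    a b refl refl = a<b
column-increasing (_ ∷ ↗)   (suc i) j       a b e₁   e₂   = column-increasing ↗ i j a b e₁ e₂
column-increasing [-]       zero    zero    a b refl ()
column-increasing [-]       zero    (suc j) a b ()   _
column-increasing (_ ∷ _)   zero    (suc j) a b ()   _
column-increasing [-]       (suc i) j       a b ()   _

column-Linked : ∀ xs →
  (∀ i a b → get (column xs) i 0 ≡ just a → get (column xs) (suc i) 0 ≡ just b → a < b) → Linked _<_ xs
column-Linked []           _   = []
column-Linked (x ∷ [])     _   = [-]
column-Linked (x ∷ y ∷ xs) inc = inc 0 x y refl refl ∷ column-Linked (y ∷ xs) (inc ∘ suc)

ColumnsIncreasing : Tableau → Set
ColumnsIncreasing T = ∀ i j a b → get T i j ≡ just a → get T (suc i) j ≡ just b → a < b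

armLeg-columns-increasing : ∀ {a r c} → Linked _<_ (a ∷ c) → ColumnsIncreasing (armLeg a r c)
armLeg-columns-increasing ↗ zero zero a b e₁ e₂ = column-increasing ↗ 0 0 a b e₁ e₂
armLeg-columns-increasing {c = c} ↗ zero (suc j) a b _ e₂ with () ← trans (sym e₂) (get-column-suc c 0 j)
armLeg-columns-increasing ↗ (suc i) j a b e₁ e₂ = column-increasing ↗ (suc i) j a b e₁ e₂

armLeg-columns-increasing⁻ : ∀ {a r c} → ColumnsIncreasing (armLeg a r c) → Linked _<_ (a ∷ c)
armLeg-columns-increasing⁻ {a} {r} {c} inc =
  column-Linked (a ∷ c) λ { zero → inc 0 0 ; (suc i) → inc (suc i) 0 }

shape-column : ∀ xs → map length (column xs) ≡ replicate (length xs) 1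
shape-column []       = refl
shape-column (x ∷ xs) = cong (1 ∷_) (shape-column xs)

singleton-rows : ∀ k rs → map length rs ≡ replicate k 1 → ∃ λ bs → rs ≡ column bs
singleton-rows zero    []                  _ = [] , refl
singleton-rows (suc k) ((y ∷ []) ∷ rs)     e
  with bs , refl ← singleton-rows k rs (∷-injectiveʳ e) = y ∷ bs , refl
singleton-rows (suc k) ([] ∷ rs)           e with () ← ∷-injectiveˡ e
singleton-rows (suc k) ((y ∷ z ∷ r) ∷ rs)  e with () ← ∷-injectiveˡ e

hookSYT-IsSYT : ∀ k w → length w ≡ k + k → countTrue w ≡ k → IsSYT (hook k) (hookSYT w)
hookSYT-IsSYT k w len count = record
  { hasShape = cong₂ _∷_ (cong suc (trans (length-indicesFrom 2 w) count))
      (trans (shape-column leg) (cong (λ m → replicate m 1) (trans (length-indicesFrom 2 (map not w)) countNot)))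
  ; rowsInc  = indicesFrom-linked w ≤-refl ∷ All.map⁺ (All.universal (λ _ → [-]) leg)
  ; colsInc  = armLeg-columns-increasing (indicesFrom-linked (map not w) ≤-refl)
  ; entries  = subst₂ _↭_
      (cong (λ l → 1 ∷ indicesFrom 2 w ++ l) (sym (concat-column leg)))
      (trans (cong (λ m → range 1 (suc m)) len) (sym (entries-hook k)))
      (↭-prep 1 (indicesFrom-↭-range 2 w))
  }
  where
  leg = indicesFrom 2 (map not w)
  countNot : countTrue (map not w) ≡ k
  countNot = +-cancelˡ-≡ k _ _ (begin
    k + countTrue (map not w)           ≡⟨ cong (_+ countTrue (map not w)) count ⟨
    countTrue w + countTrue (map not w) ≡⟨ countTrue+countTrue-not w ⟩
    length w                            ≡⟨ len ⟩
    k + k                               ∎)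
    where open ≡-Reasoning

IsSYT-hook⇒hookSYT : ∀ k P → IsSYT (hook k) P → ∃ λ w → length w ≡ k + k × P ≡ hookSYT w
IsSYT-hook⇒hookSYT k []              syt with () ← IsSYT.hasShape syt
IsSYT-hook⇒hookSYT k ([] ∷ rs)       syt with () ← ∷-injectiveˡ (IsSYT.hasShape syt)
IsSYT-hook⇒hookSYT k ((x ∷ as) ∷ rs) syt
  with bs , refl ← singleton-rows k rs (∷-injectiveʳ (IsSYT.hasShape syt))
  with increasing-partition (suc (k + k)) 1 (All.head (IsSYT.rowsInc syt))
         (Linked.tail (armLeg-columns-increasing⁻ (IsSYT.colsInc syt)))
         (subst₂ _↭_ (cong (λ l → x ∷ as ++ l) (concat-column bs)) (entries-hook k) (IsSYT.entries syt))
... | true  ∷ w , len , refl , refl = w , suc-injective len , refl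
... | false ∷ w , _   , x∷as≡ , refl = ⊥-elim (<⇒≱ x<1 (<⇒≤ 2≤x))
  where
  x<1 : x < 1
  x<1 = Linked.head (armLeg-columns-increasing⁻ (IsSYT.colsInc syt))
  2≤x : 2 ≤ x
  2≤x = All.head (subst (All (2 ≤_)) (sym x∷as≡) (indicesFrom-≥ 2 w))

-- Self-dual words

mirror : List Bool → List Bool
mirror u = u ++ dual u

length-dual : ∀ w → length (dual w) ≡ length w
length-dual w = trans (length-map not (reverse w)) (length-reverse w)

dual-++ : ∀ u v → dual (u ++ v) ≡ dual v ++ dual u
dual-++ u v = trans (cong (map not) (reverse-++ u v)) (map-++ not (reverse v) (reverse u))

dual-involutive : ∀ w → dual (dual w) ≡ w
dual-involutive w = begin
  map not (reverse (map not (reverse w)))  ≡⟨ cong (map not) (reverse-map not (reverse w)) ⟨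
  map not (map not (reverse (reverse w)))  ≡⟨ map-not-involutive _ ⟩
  reverse (reverse w)                      ≡⟨ reverse-involutive w ⟩
  w                                        ∎
  where open ≡-Reasoning

dual-mirror : ∀ u → dual (mirror u) ≡ mirror u
dual-mirror u = trans (dual-++ u (dual u)) (cong (_++ dual u) (dual-involutive u))

length-mirror : ∀ u → length (mirror u) ≡ length u + length u
length-mirror u = trans (length-++ u) (cong (length u +_) (length-dual u))

countTrue-++ : ∀ u v → countTrue (u ++ v) ≡ countTrue u + countTrue v
countTrue-++ []          v = refl
countTrue-++ (true ∷ u)  v = cong suc (countTrue-++ u v)
countTrue-++ (false ∷ u) v = countTrue-++ u v

countTrue-reverse : ∀ w → countTrue (reverse w) ≡ countTrue w
countTrue-reverse []      = refl
countTrue-reverse (b ∷ w) = begin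
  countTrue (reverse (b ∷ w))           ≡⟨ cong countTrue (unfold-reverse b w) ⟩
  countTrue (reverse w ++ [ b ])        ≡⟨ countTrue-++ (reverse w) [ b ] ⟩
  countTrue (reverse w) + countTrue [ b ] ≡⟨ cong (_+ countTrue [ b ]) (countTrue-reverse w) ⟩
  countTrue w + countTrue [ b ]         ≡⟨ +-comm (countTrue w) _ ⟩
  countTrue [ b ] + countTrue w         ≡⟨ countTrue-++ [ b ] w ⟨
  countTrue (b ∷ w)                     ∎
  where open ≡-Reasoning

countTrue-mirror : ∀ u → countTrue (mirror u) ≡ length u
countTrue-mirror u = begin
  countTrue (u ++ map not (reverse u))         ≡⟨ countTrue-++ u _ ⟩
  countTrue u + countTrue (map not (reverse u)) ≡⟨ cong (λ v → countTrue u + countTrue v) (reverse-map not u) ⟩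
  countTrue u + countTrue (reverse (map not u)) ≡⟨ cong (countTrue u +_) (countTrue-reverse (map not u)) ⟩
  countTrue u + countTrue (map not u)           ≡⟨ countTrue+countTrue-not u ⟩
  length u                                      ∎
  where open ≡-Reasoning

++-cancel-equal-length : ∀ {A : Set} (xs ys : List A) {zs ws} → length xs ≡ length ys →
                         xs ++ zs ≡ ys ++ ws → xs ≡ ys × zs ≡ ws
++-cancel-equal-length []       []       _   e = refl , e
++-cancel-equal-length (x ∷ xs) (y ∷ ys) len e
  with xs≡ , zs≡ ← ++-cancel-equal-length xs ys (suc-injective len) (∷-injectiveʳ e)
  = cong₂ _∷_ (∷-injectiveˡ e) xs≡ , zs≡

m+m≡n+n⇒m≡n : ∀ {m n} → m + m ≡ n + n → m ≡ n
m+m≡n+n⇒m≡n {zero}  {zero}  _ = refl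
m+m≡n+n⇒m≡n {suc m} {suc n} e =
  cong suc (m+m≡n+n⇒m≡n (suc-injective (trans (sym (+-suc m m)) (trans (suc-injective e) (+-suc n n)))))

mirror-injective : ∀ {u v} → mirror u ≡ mirror v → u ≡ v
mirror-injective {u} {v} e = proj₁ (++-cancel-equal-length u v
  (m+m≡n+n⇒m≡n (trans (sym (length-mirror u)) (trans (cong length e) (length-mirror v)))) e)

dual-fixed⇒mirror : ∀ k w → length w ≡ k + k → dual w ≡ w → ∃ λ u → length u ≡ k × w ≡ mirror u
dual-fixed⇒mirror k w len fixed = u , length-u , trans (sym (take++drop≡id k w)) (cong (u ++_) (sym dual-u≡v))
  where
  u = Data.List.take k w
  v = Data.List.drop k w
  length-u : length u ≡ k
  length-u = trans (length-take k w) (trans (cong (k ⊓_) len) (m≤n⇒m⊓n≡m (m≤m+n k k)))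
  length-v : length v ≡ k
  length-v = trans (length-drop k w) (trans (cong (_∸ k) len) (m+n∸m≡n k k))
  dual-u≡v : dual u ≡ v
  dual-u≡v = proj₂ (++-cancel-equal-length (dual v) u (trans (length-dual v) (trans length-v (sym length-u)))
    (begin
      dual v ++ dual u   ≡⟨ dual-++ u v ⟨
      dual (u ++ v)      ≡⟨ cong dual (take++drop≡id k w) ⟩
      dual w             ≡⟨ fixed ⟩
      w                  ≡⟨ take++drop≡id k w ⟨
      u ++ v             ∎))
    where open ≡-Reasoning

allWords : ℕ → List (List Bool)
allWords zero    = [ [] ]
allWords (suc k) = map (true ∷_) (allWords k) ++ map (false ∷_) (allWords k)

length-allWords : ∀ k → length (allWords k) ≡ 2 ^ k
length-allWords zero    = refl
length-allWords (suc k) = begin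
  length (map (true ∷_) (allWords k) ++ map (false ∷_) (allWords k))
    ≡⟨ length-++ (map (true ∷_) (allWords k)) ⟩
  length (map (true ∷_) (allWords k)) + length (map (false ∷_) (allWords k))
    ≡⟨ cong₂ _+_ (length-map _ (allWords k)) (length-map _ (allWords k)) ⟩
  length (allWords k) + length (allWords k)
    ≡⟨ cong₂ _+_ (length-allWords k) (trans (length-allWords k) (sym (+-identityʳ _))) ⟩
  2 ^ k + (2 ^ k + 0) ∎
  where open ≡-Reasoning

∈-allWords : ∀ u → u ∈ allWords (length u)
∈-allWords []          = here refl
∈-allWords (true ∷ u)  = ∈-++⁺ˡ (∈-map⁺ (true ∷_) (∈-allWords u))
∈-allWords (false ∷ u) = ∈-++⁺ʳ (map (true ∷_) (allWords (length u))) (∈-map⁺ (false ∷_) (∈-allWords u))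

∈-allWords⇒length : ∀ k {u} → u ∈ allWords k → length u ≡ k
∈-allWords⇒length zero    (here refl) = refl
∈-allWords⇒length (suc k) u∈ with ∈-++⁻ (map (true ∷_) (allWords k)) u∈
... | inj₁ u∈₁ with v , v∈ , refl ← ∈-map⁻ (true ∷_) u∈₁  = cong suc (∈-allWords⇒length k v∈)
... | inj₂ u∈₂ with v , v∈ , refl ← ∈-map⁻ (false ∷_) u∈₂ = cong suc (∈-allWords⇒length k v∈)

allWords-Unique : ∀ k → Unique (allWords k)
allWords-Unique zero    = [] ∷ []
allWords-Unique (suc k) =
  Unique.++⁺ (Unique.map⁺ ∷-injectiveʳ (allWords-Unique k)) (Unique.map⁺ ∷-injectiveʳ (allWords-Unique k)) disjoint
  where
  disjoint : ∀ {v} → v ∈ map (true ∷_) (allWords k) × v ∈ map (false ∷_) (allWords k) → ⊥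
  disjoint (v∈₁ , v∈₂)
    with _ , _ , refl ← ∈-map⁻ (true ∷_) v∈₁
    with _ , _ , ()   ← ∈-map⁻ (false ∷_) v∈₂

lemma4p7 : (k : ℕ) → Σ (List Tableau) (λ L → Unique L × ((P : Tableau) → (P ∈ L ⇔ (IsSYT (hook k) P × (ε P) ᵀ ≡ P))) × length L ≡ 2 ^ k)
lemma4p7 k = map (hookSYT ∘ mirror) (allWords k)
           , Unique.map⁺ (mirror-injective ∘ hookSYT-injective) (allWords-Unique k)
           , (λ P → mk⇔ (sound P) (complete P))
           , trans (length-map _ (allWords k)) (length-allWords k)
  where
  sound : ∀ P → P ∈ map (hookSYT ∘ mirror) (allWords k) → IsSYT (hook k) P × (ε P) ᵀ ≡ P
  sound P P∈ with u , u∈ , refl ← ∈-map⁻ (hookSYT ∘ mirror) P∈ =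
      hookSYT-IsSYT k (mirror u) (trans (length-mirror u) (cong₂ _+_ len len)) (trans (countTrue-mirror u) len)
    , trans (εᵀ-hookSYT (mirror u)) (cong hookSYT (dual-mirror u))
    where len = ∈-allWords⇒length k u∈
  complete : ∀ P → IsSYT (hook k) P × (ε P) ᵀ ≡ P → P ∈ map (hookSYT ∘ mirror) (allWords k)
  complete P (syt , self-dual)
    with w , len , refl ← IsSYT-hook⇒hookSYT k P syt
    with u , refl , refl ← dual-fixed⇒mirror k w len (hookSYT-injective (trans (sym (εᵀ-hookSYT w)) self-dual))
    = ∈-map⁺ (hookSYT ∘ mirror) (∈-allWords u)
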